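{- Let $n,d\ge 1$ be integers and let $X=(X_1,\dots,X_n)$ be $d$-wise independent unbiased binary random variables. If $d$ is even, then \[ H_{\min}(X)\ge\log\Bigl(\sum_{i=0}^{d/2}\binom ni\Bigr). \] If $d$ is odd, then \[ H_{\min}(X)\ge\log\Bigl(\sum_{i=0}^{(d-1)/2}\binom ni+\binom{n-1}{(d-1)/2}\Bigr). \]
   Context: A binary random variable is unbiased if it takes values $0$ and $1$ each with probability $1/2$. $X_1,\dots,X_n$ are $d$-wise independent if for every $S\subseteq[n]$ with $|S|\le d$ the variables $(X_i)_{i\in S}$ are mutually independent (for $d\le n$ this is equivalent to requiring it for all $S$ with $|S|=d$). $H_{\min}(X)=\min_x\log\frac{1}{\Pr[X=x]}$ (minimum over $x$ in the support) is the min-entropy; logarithms are base $2$; $\binom{a}{b}=0$ if $b>a$.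
   Formalization: The probabilities $\Pr[X=x]$ of the joint distribution of the binary random variables are rational numbers. -}

module Defs where

open import Data.Bool using (Bool; true; false; if_then_else_; _∧_)
open import Data.Nat as ℕ using (ℕ; zero; suc)
open import Data.Nat.Combinatorics using (_C_)
open import Data.Fin using (Fin)
open import Data.Fin.Subset using (Subset; _∈_; ∣_∣)
open import Data.Vec using (Vec; []; _∷_; lookup)
open import Data.List using (List; []; _∷_; map; _++_; upTo; foldr)
import Data.Nat.ListAction
open import Data.List.Base using (allFin)
open import Data.Integer using (+_)
open import Data.Rational using (ℚ; 0ℚ; 1ℚ; _+_; _*_; _/_; _≤_; ½)
open import Data.Fin.Subset.Properties using (_∈?_)
open import Relation.Nullary.Decidable using (does)
open import Relation.Binary.PropositionalEquality using (_≡_)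

-- all outcomes {0,1}^n (true = 1, false = 0)
allVecs : (n : ℕ) → List (Vec Bool n)
allVecs zero = [] ∷ []
allVecs (suc n) = map (true ∷_) (allVecs n) ++ map (false ∷_) (allVecs n)

sumℚ : List ℚ → ℚ
sumℚ = foldr _+_ 0ℚ

prodℚ : List ℚ → ℚ
prodℚ = foldr _*_ 1ℚ

-- a probability distribution on {0,1}^n, i.e. the law of X = (X_1,…,X_n)
record Dist (n : ℕ) : Set where
  field
    pr      : Vec Bool n → ℚ
    nonneg  : ∀ x → 0ℚ ≤ pr x
    total   : sumℚ (map pr (allVecs n)) ≡ 1ℚ
open Dist public

_==ᵇ_ : Bool → Bool → Bool
true  ==ᵇ true  = true
false ==ᵇ false = true
_     ==ᵇ _     = false

agreeOn : ∀ {n} → Subset n → Vec Bool n → Vec Bool n → Bool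
agreeOn S a x = foldr _∧_ true
  (map (λ i → if does (i ∈? S) then (lookup x i ==ᵇ lookup a i) else true) (allFin _))

PrAgree : ∀ {n} → Dist n → Subset n → Vec Bool n → ℚ
PrAgree {n} P S a =
  sumℚ (map (λ x → if agreeOn S a x then pr P x else 0ℚ) (allVecs n))

PrCoord : ∀ {n} → Dist n → Fin n → Bool → ℚ
PrCoord {n} P i b =
  sumℚ (map (λ x → if lookup x i ==ᵇ b then pr P x else 0ℚ) (allVecs n))

Unbiased : ∀ {n} → Dist n → Set
Unbiased P = ∀ i → PrCoord P i true ≡ ½

IndependentOn : ∀ {n} → Dist n → Subset n → Set
IndependentOn {n} P S = ∀ (a : Vec Bool n) →
  PrAgree P S a ≡
    prodℚ (map (λ i → if does (i ∈? S) then PrCoord P i (lookup a i) else 1ℚ) (allFin n))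

DWiseIndependent : ∀ {n} → ℕ → Dist n → Set
DWiseIndependent {n} d P = ∀ (S : Subset n) → ∣ S ∣ ℕ.≤ d → IndependentOn P S

ℕtoℚ : ℕ → ℚ
ℕtoℚ m = + m / 1

-- H_min(X) ≥ log M, i.e. Pr[X = x] ≤ 1/M for every x in the support
-- (stated multiplicatively: Pr[X = x] * M ≤ 1)
MinEntropyAtLeastLog : ∀ {n} → Dist n → ℕ → Set
MinEntropyAtLeastLog P M = ∀ x → pr P x * ℕtoℚ M ≤ 1ℚ

binomSum : ℕ → ℕ → ℕ
binomSum n k = Data.Nat.ListAction.sum (map (n C_) (upTo (suc k)))

{-# OPTIONS --safe #-}
-- For S ⊆ [n] let χ_S(y) = (−1)^∣S ∩ y∣.  An unbiased d-wise independent X has uniform marginals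
-- on every set of at most d coordinates, so E[χ_U(X)] = [U = ∅] whenever ∣U∣ ≤ d.  Fix x and a
-- family F of sets any two of which have symmetric difference of size at most d, and put
-- g = Σ_{S ∈ F} χ_S(x) χ_S.  Then g(x) = ∣F∣, while expanding the square and using the
-- orthogonality above gives E[g(X)²] = ∣F∣.  Hence Pr[X = x] ∣F∣² ≤ E[g(X)²] = ∣F∣.
-- For d = 2k take F = {S : ∣S∣ ≤ k}; for d = 2k + 1 take the sets with at most k elements
-- besides the first coordinate, of which there are
-- 2 Σ_{i ≤ k} C(n−1, i) = Σ_{i ≤ k} C(n, i) + C(n−1, k).
module Submission where

open import Defs
open import Data.Bool using (Bool; true; false; if_then_else_; _∧_; _xor_; T)
open import Data.Fin.Subset using (Subset; ∣_∣)
open import Data.Fin.Subset.Properties using (_∈?_)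
open import Data.List using ([]; _∷_; map; _++_; foldr; tabulate; allFin; upTo)
import Data.List.Properties as List
open import Data.Product using (_×_; _,_)
open import Data.Sum using (inj₁; inj₂)
open import Data.Vec using (Vec; []; _∷_; lookup; zipWith; tail)
open import Function using (_∘_)
open import Relation.Binary.PropositionalEquality
  using (_≡_; refl; sym; trans; cong; cong₂; subst; subst₂; module ≡-Reasoning)
open import Relation.Nullary.Decidable using (does)
import Data.Nat as ℕ
import Data.Nat.Properties as ℕ
open import Data.Nat using (ℕ; zero; suc)

_Δ_ : ∀ {n} → Subset n → Subset n → Subset n
_Δ_ = zipWith _xor_

count : ∀ {n} → (Vec Bool n → Bool) → ℕ
count {zero}  F = if F [] then 1 else 0
count {suc n} F = count (λ v → F (true ∷ v)) ℕ.+ count (λ v → F (false ∷ v))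

DiameterAtMost : ∀ {n} → ℕ → (Subset n → Bool) → Set
DiameterAtMost d F = ∀ S S′ → T (F S) → T (F S′) → ∣ S Δ S′ ∣ ℕ.≤ d

-- Phrased with <ᵇ so that atMost (suc k) (true ∷ S) reduces to atMost k S.
atMost : ∀ {n} → ℕ → Subset n → Bool
atMost k S = ∣ S ∣ ℕ.<ᵇ suc k

module Fourier where

  import Data.Maybe as Maybe
  open import Data.Rational
    using (ℚ; 0ℚ; 1ℚ; ½; _+_; _*_; -_; _≤_; _/_; mkℚ; nonNegative; nonPositive)
  import Data.Rational.Properties as ℚ
  open import Data.Nat.Coprimality using (1-coprimeTo) renaming (sym to coprime-sym)
  import Data.Integer as ℤ
  import Data.Integer.Properties as ℤ
  open import Relation.Nullary.Decidable using (dec⇒maybe)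
  open import Tactic.RingSolver using (solve-∀)
  open import Tactic.RingSolver.Core.AlmostCommutativeRing
    using (AlmostCommutativeRing; fromCommutativeRing)
  open import Algebra.Bundles using (CommutativeMonoid)
  open import Algebra.Properties.CommutativeSemigroup
    (CommutativeMonoid.commutativeSemigroup ℚ.+-0-commutativeMonoid)
    using () renaming (interchange to +-interchange)
  open import Algebra.Properties.CommutativeSemigroup
    (CommutativeMonoid.commutativeSemigroup ℚ.*-1-commutativeMonoid)
    using () renaming (interchange to *-interchange; x∙yz≈y∙xz to *-left-comm)
  open ≡-Reasoning

  ℚ-ring : AlmostCommutativeRing _ _
  ℚ-ring = fromCommutativeRing ℚ.+-*-commutativeRing
    (λ q → Maybe.map sym (dec⇒maybe (q ℚ.≟ 0ℚ)))

  𝟙 : Bool → ℚ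
  𝟙 b = if b then 1ℚ else 0ℚ

  𝟙-∧ : ∀ b c → 𝟙 (b ∧ c) ≡ 𝟙 b * 𝟙 c
  𝟙-∧ true  c = sym (ℚ.*-identityˡ (𝟙 c))
  𝟙-∧ false c = sym (ℚ.*-zeroˡ (𝟙 c))

  𝟙-idem : ∀ b → 𝟙 b * 𝟙 b ≡ 𝟙 b
  𝟙-idem true  = refl
  𝟙-idem false = refl

  if-then-0 : ∀ b q → (if b then q else 0ℚ) ≡ q * 𝟙 b
  if-then-0 true  q = sym (ℚ.*-identityʳ q)
  if-then-0 false q = sym (ℚ.*-zeroʳ q)

  𝟙-guard : ∀ b {p q} → (T b → p ≡ q) → 𝟙 b * p ≡ 𝟙 b * q
  𝟙-guard true  p≡q = cong (1ℚ *_) (p≡q _)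
  𝟙-guard false {p} {q} _ = trans (ℚ.*-zeroˡ p) (sym (ℚ.*-zeroˡ q))

  sumℚ-++ : ∀ xs ys → sumℚ (xs ++ ys) ≡ sumℚ xs + sumℚ ys
  sumℚ-++ []       ys = sym (ℚ.+-identityˡ (sumℚ ys))
  sumℚ-++ (x ∷ xs) ys = trans (cong (x +_) (sumℚ-++ xs ys)) (sym (ℚ.+-assoc x (sumℚ xs) (sumℚ ys)))

  ∑ : ∀ {n} → (Vec Bool n → ℚ) → ℚ
  ∑ {zero}  f = f []
  ∑ {suc n} f = ∑ (λ v → f (true ∷ v)) + ∑ (λ v → f (false ∷ v))

  sumℚ-allVecs : ∀ {n} (f : Vec Bool n → ℚ) → sumℚ (map f (allVecs n)) ≡ ∑ f
  sumℚ-allVecs {zero}  f = ℚ.+-identityʳ (f [])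
  sumℚ-allVecs {suc n} f = begin
    sumℚ (map f (map (true ∷_) (allVecs n) ++ map (false ∷_) (allVecs n)))
      ≡⟨ cong sumℚ (List.map-++ f (map (true ∷_) (allVecs n)) _) ⟩
    sumℚ (map f (map (true ∷_) (allVecs n)) ++ map f (map (false ∷_) (allVecs n)))
      ≡⟨ sumℚ-++ (map f (map (true ∷_) (allVecs n))) _ ⟩
    sumℚ (map f (map (true ∷_) (allVecs n))) + sumℚ (map f (map (false ∷_) (allVecs n)))
      ≡⟨ cong₂ _+_ (half true) (half false) ⟩
    ∑ f ∎
    where
    half : ∀ b → sumℚ (map f (map (b ∷_) (allVecs n))) ≡ ∑ (λ v → f (b ∷ v))
    half b = trans (cong sumℚ (sym (List.map-∘ (allVecs n)))) (sumℚ-allVecs (λ v → f (b ∷ v)))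

  ∑-cong : ∀ {n} {f g : Vec Bool n → ℚ} → (∀ v → f v ≡ g v) → ∑ f ≡ ∑ g
  ∑-cong {zero}  f≡g = f≡g []
  ∑-cong {suc n} f≡g = cong₂ _+_ (∑-cong (λ v → f≡g (true ∷ v))) (∑-cong (λ v → f≡g (false ∷ v)))

  ∑-zero : ∀ {n} → ∑ {n} (λ _ → 0ℚ) ≡ 0ℚ
  ∑-zero {zero}  = refl
  ∑-zero {suc n} = cong₂ _+_ (∑-zero {n}) (∑-zero {n})

  ∑-distrib-+ : ∀ {n} (f g : Vec Bool n → ℚ) → ∑ (λ v → f v + g v) ≡ ∑ f + ∑ g
  ∑-distrib-+ {zero}  f g = refl
  ∑-distrib-+ {suc n} f g = begin
    ∑ (λ v → f (true ∷ v) + g (true ∷ v)) + ∑ (λ v → f (false ∷ v) + g (false ∷ v))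
      ≡⟨ cong₂ _+_ (∑-distrib-+ f₁ g₁) (∑-distrib-+ f₀ g₀) ⟩
    (∑ f₁ + ∑ g₁) + (∑ f₀ + ∑ g₀)
      ≡⟨ +-interchange (∑ f₁) (∑ g₁) (∑ f₀) (∑ g₀) ⟩
    ∑ f + ∑ g ∎
    where
    f₁ f₀ g₁ g₀ : Vec Bool n → ℚ
    f₁ v = f (true ∷ v)
    f₀ v = f (false ∷ v)
    g₁ v = g (true ∷ v)
    g₀ v = g (false ∷ v)

  *-distribˡ-∑ : ∀ {n} c (f : Vec Bool n → ℚ) → c * ∑ f ≡ ∑ (λ v → c * f v)
  *-distribˡ-∑ {zero}  c f = refl
  *-distribˡ-∑ {suc n} c f = trans (ℚ.*-distribˡ-+ c _ _)
    (cong₂ _+_ (*-distribˡ-∑ c (λ v → f (true ∷ v))) (*-distribˡ-∑ c (λ v → f (false ∷ v))))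

  ∑-comm : ∀ {m n} (f : Vec Bool m → Vec Bool n → ℚ) →
    ∑ (λ v → ∑ (λ w → f v w)) ≡ ∑ (λ w → ∑ (λ v → f v w))
  ∑-comm {zero}  f = refl
  ∑-comm {suc m} f = trans (cong₂ _+_ (∑-comm (λ v → f (true ∷ v))) (∑-comm (λ v → f (false ∷ v))))
    (sym (∑-distrib-+ (λ w → ∑ (λ v → f (true ∷ v) w)) (λ w → ∑ (λ v → f (false ∷ v) w))))

  ∑-*-∑ : ∀ {n} (f g : Vec Bool n → ℚ) → ∑ f * ∑ g ≡ ∑ (λ v → ∑ (λ w → f v * g w))
  ∑-*-∑ f g = begin
    ∑ f * ∑ g                     ≡⟨ ℚ.*-comm (∑ f) (∑ g) ⟩
    ∑ g * ∑ f                     ≡⟨ *-distribˡ-∑ (∑ g) f ⟩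
    ∑ (λ v → ∑ g * f v)
      ≡⟨ ∑-cong (λ v → trans (ℚ.*-comm (∑ g) (f v)) (*-distribˡ-∑ (f v) g)) ⟩
    ∑ (λ v → ∑ (λ w → f v * g w)) ∎

  ∑-nonneg : ∀ {n} {f : Vec Bool n → ℚ} → (∀ v → 0ℚ ≤ f v) → 0ℚ ≤ ∑ f
  ∑-nonneg {zero}  f≥0 = f≥0 []
  ∑-nonneg {suc n} f≥0 =
    ℚ.+-mono-≤ (∑-nonneg (λ v → f≥0 (true ∷ v))) (∑-nonneg (λ v → f≥0 (false ∷ v)))

  term≤∑ : ∀ {n} {f : Vec Bool n → ℚ} → (∀ v → 0ℚ ≤ f v) → ∀ v → f v ≤ ∑ f
  term≤∑ {zero}  f≥0 [] = ℚ.≤-refl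
  term≤∑ {suc n} {f} f≥0 (true ∷ v) = ℚ.≤-trans (term≤∑ (λ w → f≥0 (true ∷ w)) v)
    (subst (_≤ ∑ f) (ℚ.+-identityʳ (∑ (λ w → f (true ∷ w))))
      (ℚ.+-monoʳ-≤ (∑ (λ w → f (true ∷ w))) (∑-nonneg (λ w → f≥0 (false ∷ w)))))
  term≤∑ {suc n} {f} f≥0 (false ∷ v) = ℚ.≤-trans (term≤∑ (λ w → f≥0 (false ∷ w)) v)
    (subst (_≤ ∑ f) (ℚ.+-identityˡ (∑ (λ w → f (false ∷ w))))
      (ℚ.+-monoˡ-≤ (∑ (λ w → f (false ∷ w))) (∑-nonneg (λ w → f≥0 (true ∷ w)))))

  sign : Bool → ℚ
  sign true  = - 1ℚ
  sign false = 1ℚ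

  χ : ∀ {n} → Subset n → Vec Bool n → ℚ
  χ []      []      = 1ℚ
  χ (s ∷ S) (y ∷ Y) = sign (s ∧ y) * χ S Y

  sign-∧-xor : ∀ s t y → sign (s ∧ y) * sign (t ∧ y) ≡ sign ((s xor t) ∧ y)
  sign-∧-xor true  true  true  = refl
  sign-∧-xor true  true  false = refl
  sign-∧-xor true  false true  = refl
  sign-∧-xor true  false false = refl
  sign-∧-xor false true  true  = refl
  sign-∧-xor false true  false = refl
  sign-∧-xor false false true  = refl
  sign-∧-xor false false false = refl

  sign-sq : ∀ b → sign b * sign b ≡ 1ℚ
  sign-sq true  = refl
  sign-sq false = refl

  χ-Δ : ∀ {n} (S S′ : Subset n) y → χ S y * χ S′ y ≡ χ (S Δ S′) y
  χ-Δ []      []        []      = refl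
  χ-Δ (s ∷ S) (s′ ∷ S′) (y ∷ Y) =
    trans (*-interchange (sign (s ∧ y)) (χ S Y) (sign (s′ ∧ y)) (χ S′ Y))
          (cong₂ _*_ (sign-∧-xor s s′ y) (χ-Δ S S′ Y))

  χ-self : ∀ {n} (S : Subset n) y → χ S y * χ S y ≡ 1ℚ
  χ-self []      []      = refl
  χ-self (s ∷ S) (y ∷ Y) =
    trans (*-interchange (sign (s ∧ y)) (χ S Y) (sign (s ∧ y)) (χ S Y))
          (cong₂ _*_ (sign-sq (s ∧ y)) (χ-self S Y))

  χ-empty : ∀ {n} (U : Subset n) y → (∣ U ∣ ℕ.≡ᵇ 0) ≡ true → χ U y ≡ 1ℚ
  χ-empty []          []      _     = refl
  χ-empty (false ∷ U) (y ∷ Y) empty = trans (ℚ.*-identityˡ (χ U Y)) (χ-empty U Y empty)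

  ∑-select : ∀ {n} (S : Subset n) (f : Subset n → ℚ) →
    ∑ (λ S′ → f S′ * 𝟙 (∣ S Δ S′ ∣ ℕ.≡ᵇ 0)) ≡ f S
  ∑-select {zero}  []          f = ℚ.*-identityʳ (f [])
  ∑-select {suc n} (true ∷ S)  f = begin
    ∑ (λ S′ → f (true ∷ S′) * 𝟙 (∣ S Δ S′ ∣ ℕ.≡ᵇ 0)) + ∑ (λ S′ → f (false ∷ S′) * 0ℚ)
      ≡⟨ cong₂ _+_ (∑-select S (λ S′ → f (true ∷ S′)))
                   (trans (∑-cong (λ S′ → ℚ.*-zeroʳ (f (false ∷ S′)))) (∑-zero {n})) ⟩
    f (true ∷ S) + 0ℚ ≡⟨ ℚ.+-identityʳ (f (true ∷ S)) ⟩
    f (true ∷ S) ∎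
  ∑-select {suc n} (false ∷ S) f = begin
    ∑ (λ S′ → f (true ∷ S′) * 0ℚ) + ∑ (λ S′ → f (false ∷ S′) * 𝟙 (∣ S Δ S′ ∣ ℕ.≡ᵇ 0))
      ≡⟨ cong₂ _+_ (trans (∑-cong (λ S′ → ℚ.*-zeroʳ (f (true ∷ S′)))) (∑-zero {n}))
                   (∑-select S (λ S′ → f (false ∷ S′))) ⟩
    0ℚ + f (false ∷ S) ≡⟨ ℚ.+-identityˡ (f (false ∷ S)) ⟩
    f (false ∷ S) ∎

  ∑-χ-nonempty : ∀ {n} (U : Subset n) → (∣ U ∣ ℕ.≡ᵇ 0) ≡ false → ∑ (χ U) ≡ 0ℚ
  ∑-χ-nonempty (true ∷ U) _ = begin
    ∑ (λ v → - 1ℚ * χ U v) + ∑ (λ v → 1ℚ * χ U v)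
      ≡⟨ cong₂ _+_ (sym (*-distribˡ-∑ (- 1ℚ) (χ U))) (sym (*-distribˡ-∑ 1ℚ (χ U))) ⟩
    - 1ℚ * ∑ (χ U) + 1ℚ * ∑ (χ U)
      ≡⟨ cancel (∑ (χ U)) ⟩
    0ℚ ∎
    where
    cancel : ∀ q → - 1ℚ * q + 1ℚ * q ≡ 0ℚ
    cancel = solve-∀ ℚ-ring
  ∑-χ-nonempty (false ∷ U) nonempty = begin
    ∑ (λ v → 1ℚ * χ U v) + ∑ (λ v → 1ℚ * χ U v)
      ≡⟨ cong₂ _+_ (sym (*-distribˡ-∑ 1ℚ (χ U))) (sym (*-distribˡ-∑ 1ℚ (χ U))) ⟩
    1ℚ * ∑ (χ U) + 1ℚ * ∑ (χ U)
      ≡⟨ cong (λ q → 1ℚ * q + 1ℚ * q) (∑-χ-nonempty U nonempty) ⟩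
    0ℚ ∎

  -- 2^(n − ∣U∣): the number of points that agree with a given point on U.
  fibreSize : ∀ {n} → Subset n → ℚ
  fibreSize []          = 1ℚ
  fibreSize (true  ∷ U) = fibreSize U
  fibreSize (false ∷ U) = fibreSize U + fibreSize U

  fibreSize-cancel : ∀ {n} (U : Subset n) {q} → fibreSize U * q ≡ 0ℚ → q ≡ 0ℚ
  fibreSize-cancel []          {q} Uq≡0 = trans (sym (ℚ.*-identityˡ q)) Uq≡0
  fibreSize-cancel (true  ∷ U)     Uq≡0 = fibreSize-cancel U Uq≡0
  fibreSize-cancel (false ∷ U) {q} Uq≡0 =
    fibreSize-cancel U (p+p≡0⇒p≡0 (trans (sym (ℚ.*-distribʳ-+ q (fibreSize U) (fibreSize U))) Uq≡0))
    where
    halve : ∀ p → p ≡ ½ * (p + p)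
    halve = solve-∀ ℚ-ring
    p+p≡0⇒p≡0 : ∀ {p} → p + p ≡ 0ℚ → p ≡ 0ℚ
    p+p≡0⇒p≡0 {p} p+p≡0 = trans (halve p) (cong (½ *_) p+p≡0)

  agreeOn-tabulate : ∀ {n} (S : Subset n) a x → agreeOn S a x ≡
    foldr _∧_ true (tabulate (λ i → if does (i ∈? S) then lookup x i ==ᵇ lookup a i else true))
  agreeOn-tabulate S a x = cong (foldr _∧_ true)
    (List.map-tabulate (λ i → i) (λ i → if does (i ∈? S) then lookup x i ==ᵇ lookup a i else true))

  agreeOn-∷ : ∀ {n} s (S : Subset n) a A x X →
    agreeOn (s ∷ S) (a ∷ A) (x ∷ X) ≡ (if s then x ==ᵇ a else true) ∧ agreeOn S A X
  agreeOn-∷ true  S a A x X =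
    trans (agreeOn-tabulate (true ∷ S) (a ∷ A) (x ∷ X))
          (cong ((x ==ᵇ a) ∧_) (sym (agreeOn-tabulate S A X)))
  agreeOn-∷ false S a A x X =
    trans (agreeOn-tabulate (false ∷ S) (a ∷ A) (x ∷ X)) (sym (agreeOn-tabulate S A X))

  ∑-agreeOn-χ : ∀ {n} (U y : Vec Bool n) →
    ∑ (λ a → 𝟙 (agreeOn U a y) * χ U a) ≡ fibreSize U * χ U y
  ∑-agreeOn-χ {zero}  []      []      = refl
  ∑-agreeOn-χ {suc n} (s ∷ U) (y ∷ Y) = begin
    ∑ (λ A → 𝟙 (agreeOn (s ∷ U) (true ∷ A) (y ∷ Y)) * χ (s ∷ U) (true ∷ A)) +
    ∑ (λ A → 𝟙 (agreeOn (s ∷ U) (false ∷ A) (y ∷ Y)) * χ (s ∷ U) (false ∷ A))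
      ≡⟨ cong₂ _+_ (∑-cong (split true)) (∑-cong (split false)) ⟩
    ∑ (λ A → w s y true * h A) + ∑ (λ A → w s y false * h A)
      ≡⟨ cong₂ _+_ (sym (*-distribˡ-∑ (w s y true) h)) (sym (*-distribˡ-∑ (w s y false) h)) ⟩
    w s y true * ∑ h + w s y false * ∑ h
      ≡⟨ cong (λ q → w s y true * q + w s y false * q) (∑-agreeOn-χ U Y) ⟩
    w s y true * (fibreSize U * χ U Y) + w s y false * (fibreSize U * χ U Y)
      ≡⟨ sym (ℚ.*-distribʳ-+ (fibreSize U * χ U Y) (w s y true) (w s y false)) ⟩
    (w s y true + w s y false) * (fibreSize U * χ U Y)
      ≡⟨ coordinate s y ⟩
    fibreSize (s ∷ U) * (sign (s ∧ y) * χ U Y) ∎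
    where
    h : Vec Bool n → ℚ
    h A = 𝟙 (agreeOn U A Y) * χ U A
    w : Bool → Bool → Bool → ℚ
    w t z a = 𝟙 (if t then z ==ᵇ a else true) * sign (t ∧ a)
    split : ∀ a A →
      𝟙 (agreeOn (s ∷ U) (a ∷ A) (y ∷ Y)) * (sign (s ∧ a) * χ U A) ≡ w s y a * h A
    split a A = begin
      𝟙 (agreeOn (s ∷ U) (a ∷ A) (y ∷ Y)) * (sign (s ∧ a) * χ U A)
        ≡⟨ cong (λ b → 𝟙 b * (sign (s ∧ a) * χ U A)) (agreeOn-∷ s U a A y Y) ⟩
      𝟙 ((if s then y ==ᵇ a else true) ∧ agreeOn U A Y) * (sign (s ∧ a) * χ U A)
        ≡⟨ cong (_* (sign (s ∧ a) * χ U A)) (𝟙-∧ (if s then y ==ᵇ a else true) (agreeOn U A Y)) ⟩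
      (𝟙 (if s then y ==ᵇ a else true) * 𝟙 (agreeOn U A Y)) * (sign (s ∧ a) * χ U A)
        ≡⟨ *-interchange (𝟙 (if s then y ==ᵇ a else true)) (𝟙 (agreeOn U A Y))
                         (sign (s ∧ a)) (χ U A) ⟩
      w s y a * h A ∎
    double : ∀ F q → (1ℚ + 1ℚ) * (F * q) ≡ (F + F) * (1ℚ * q)
    double = solve-∀ ℚ-ring
    coordinate : ∀ t z →
      (w t z true + w t z false) * (fibreSize U * χ U Y) ≡ fibreSize (t ∷ U) * (sign (t ∧ z) * χ U Y)
    coordinate true  true  = *-left-comm (sign true) (fibreSize U) (χ U Y)
    coordinate true  false = *-left-comm (sign false) (fibreSize U) (χ U Y)
    coordinate false z     = double (fibreSize U) (χ U Y)

  ∑-pr : ∀ {n} (P : Dist n) → ∑ (pr P) ≡ 1ℚ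
  ∑-pr P = trans (sym (sumℚ-allVecs (pr P))) (total P)

  PrCoord-true+false : ∀ {n} (P : Dist n) i → PrCoord P i true + PrCoord P i false ≡ 1ℚ
  PrCoord-true+false {n} P i = begin
    PrCoord P i true + PrCoord P i false
      ≡⟨ cong₂ _+_ (sumℚ-allVecs (coord true)) (sumℚ-allVecs (coord false)) ⟩
    ∑ (coord true) + ∑ (coord false)
      ≡⟨ sym (∑-distrib-+ (coord true) (coord false)) ⟩
    ∑ (λ x → coord true x + coord false x)
      ≡⟨ ∑-cong (λ x → split (lookup x i) (pr P x)) ⟩
    ∑ (pr P)
      ≡⟨ ∑-pr P ⟩
    1ℚ ∎
    where
    coord : Bool → Vec Bool n → ℚ
    coord b x = if lookup x i ==ᵇ b then pr P x else 0ℚ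
    split : ∀ b p → (if b ==ᵇ true then p else 0ℚ) + (if b ==ᵇ false then p else 0ℚ) ≡ p
    split true  p = ℚ.+-identityʳ p
    split false p = ℚ.+-identityˡ p

  Unbiased⇒PrCoord≡½ : ∀ {n} {P : Dist n} → Unbiased P → ∀ i b → PrCoord P i b ≡ ½
  Unbiased⇒PrCoord≡½ unbiased i true  = unbiased i
  Unbiased⇒PrCoord≡½ {P = P} unbiased i false = begin
    PrCoord P i false
      ≡⟨ add-sub (PrCoord P i false) ⟩
    (½ + PrCoord P i false) + - ½
      ≡⟨ cong (λ q → (q + PrCoord P i false) + - ½) (sym (unbiased i)) ⟩
    (PrCoord P i true + PrCoord P i false) + - ½
      ≡⟨ cong (_+ - ½) (PrCoord-true+false P i) ⟩
    1ℚ + - ½ ∎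
    where
    add-sub : ∀ q → q ≡ (½ + q) + - ½
    add-sub = solve-∀ ℚ-ring

  PrAgree-constant : ∀ {n} {P : Dist n} {U} → Unbiased P → IndependentOn P U →
    ∀ a → PrAgree P U a ≡ prodℚ (map (λ i → if does (i ∈? U) then ½ else 1ℚ) (allFin n))
  PrAgree-constant {n} {P} {U} unbiased independent a = trans (independent a)
    (cong prodℚ (List.map-cong (λ i → cong (λ q → if does (i ∈? U) then q else 1ℚ)
                                           (Unbiased⇒PrCoord≡½ {P = P} unbiased i (lookup a i)))
                               (allFin n)))

  𝔼 : ∀ {n} → Dist n → (Vec Bool n → ℚ) → ℚ
  𝔼 P f = ∑ (λ x → pr P x * f x)

  𝔼-cong : ∀ {n} (P : Dist n) {f g} → (∀ x → f x ≡ g x) → 𝔼 P f ≡ 𝔼 P g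
  𝔼-cong P f≡g = ∑-cong (λ x → cong (pr P x *_) (f≡g x))

  𝔼-*ˡ : ∀ {n} (P : Dist n) c f → 𝔼 P (λ x → c * f x) ≡ c * 𝔼 P f
  𝔼-*ˡ P c f = trans (∑-cong (λ x → *-left-comm (pr P x) c (f x)))
                     (sym (*-distribˡ-∑ c (λ x → pr P x * f x)))

  𝔼-∑ : ∀ {n m} (P : Dist n) (f : Vec Bool m → Vec Bool n → ℚ) →
    𝔼 P (λ x → ∑ (λ v → f v x)) ≡ ∑ (λ v → 𝔼 P (f v))
  𝔼-∑ P f = trans (∑-cong (λ x → *-distribˡ-∑ (pr P x) (λ v → f v x)))
                  (∑-comm (λ x v → pr P x * f v x))

  PrAgree≡𝔼 : ∀ {n} (P : Dist n) U a → PrAgree P U a ≡ 𝔼 P (λ x → 𝟙 (agreeOn U a x))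
  PrAgree≡𝔼 P U a = trans (sumℚ-allVecs (λ x → if agreeOn U a x then pr P x else 0ℚ))
                          (∑-cong (λ x → if-then-0 (agreeOn U a x) (pr P x)))

  constantMarginal⇒𝔼χ≡0 : ∀ {n} {P : Dist n} {U c} → (∀ a → PrAgree P U a ≡ c) →
    (∣ U ∣ ℕ.≡ᵇ 0) ≡ false → 𝔼 P (χ U) ≡ 0ℚ
  constantMarginal⇒𝔼χ≡0 {P = P} {U} {c} constant nonempty = fibreSize-cancel U (begin
    fibreSize U * 𝔼 P (χ U)
      ≡⟨ sym (𝔼-*ˡ P (fibreSize U) (χ U)) ⟩
    𝔼 P (λ x → fibreSize U * χ U x)
      ≡⟨ 𝔼-cong P (λ x → sym (∑-agreeOn-χ U x)) ⟩
    𝔼 P (λ x → ∑ (λ a → 𝟙 (agreeOn U a x) * χ U a))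
      ≡⟨ 𝔼-∑ P (λ a x → 𝟙 (agreeOn U a x) * χ U a) ⟩
    ∑ (λ a → 𝔼 P (λ x → 𝟙 (agreeOn U a x) * χ U a))
      ≡⟨ ∑-cong (λ a → trans (𝔼-cong P (λ x → ℚ.*-comm (𝟙 (agreeOn U a x)) (χ U a)))
                              (𝔼-*ˡ P (χ U a) (λ x → 𝟙 (agreeOn U a x)))) ⟩
    ∑ (λ a → χ U a * 𝔼 P (λ x → 𝟙 (agreeOn U a x)))
      ≡⟨ ∑-cong (λ a → cong (χ U a *_) (trans (sym (PrAgree≡𝔼 P U a)) (constant a))) ⟩
    ∑ (λ a → χ U a * c)
      ≡⟨ ∑-cong (λ a → ℚ.*-comm (χ U a) c) ⟩
    ∑ (λ a → c * χ U a)
      ≡⟨ sym (*-distribˡ-∑ c (χ U)) ⟩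
    c * ∑ (χ U)
      ≡⟨ cong (c *_) (∑-χ-nonempty U nonempty) ⟩
    c * 0ℚ
      ≡⟨ ℚ.*-zeroʳ c ⟩
    0ℚ ∎)

  -- Fourier form of d-wise uniformity (any d coordinates are jointly uniform).
  DWiseUniform : ∀ {n} → ℕ → Dist n → Set
  DWiseUniform d P = ∀ U → ∣ U ∣ ℕ.≤ d → 𝔼 P (χ U) ≡ 𝟙 (∣ U ∣ ℕ.≡ᵇ 0)

  DWiseIndependent⇒DWiseUniform : ∀ {n} d {P : Dist n} → Unbiased P → DWiseIndependent d P →
    DWiseUniform d P
  DWiseIndependent⇒DWiseUniform d {P} unbiased independent U ∣U∣≤d with ∣ U ∣ ℕ.≡ᵇ 0 in isEmpty
  ... | true  = trans (𝔼-cong P (λ x → χ-empty U x isEmpty))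
                     (trans (∑-cong (λ x → ℚ.*-identityʳ (pr P x))) (∑-pr P))
  ... | false = constantMarginal⇒𝔼χ≡0 {P = P}
                  (PrAgree-constant {P = P} unbiased (independent U ∣U∣≤d)) isEmpty

  peak : ∀ {n} → (Subset n → Bool) → Vec Bool n → Vec Bool n → ℚ
  peak F x y = ∑ (λ S → (𝟙 (F S) * χ S x) * χ S y)

  peak-self : ∀ {n} (F : Subset n → Bool) x → peak F x x ≡ ∑ (λ S → 𝟙 (F S))
  peak-self F x = ∑-cong (λ S → begin
    (𝟙 (F S) * χ S x) * χ S x ≡⟨ ℚ.*-assoc (𝟙 (F S)) (χ S x) (χ S x) ⟩
    𝟙 (F S) * (χ S x * χ S x) ≡⟨ cong (𝟙 (F S) *_) (χ-self S x) ⟩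
    𝟙 (F S) * 1ℚ              ≡⟨ ℚ.*-identityʳ (𝟙 (F S)) ⟩
    𝟙 (F S)                   ∎)

  𝔼-peak² : ∀ {n} d (P : Dist n) → DWiseUniform d P → (F : Subset n → Bool) → DiameterAtMost d F →
    ∀ x → 𝔼 P (λ y → peak F x y * peak F x y) ≡ ∑ (λ S → 𝟙 (F S))
  𝔼-peak² {n} d P uniform F diameter x = begin
    𝔼 P (λ y → peak F x y * peak F x y)
      ≡⟨ 𝔼-cong P (λ y → trans (∑-*-∑ (λ S → weight S * χ S y) (λ S′ → weight S′ * χ S′ y))
                               (∑-cong (λ S → ∑-cong (λ S′ → product S S′ y)))) ⟩
    𝔼 P (λ y → ∑ (λ S → ∑ (λ S′ → (weight S * weight S′) * χ (S Δ S′) y)))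
      ≡⟨ 𝔼-∑ P (λ S y → ∑ (λ S′ → (weight S * weight S′) * χ (S Δ S′) y)) ⟩
    ∑ (λ S → 𝔼 P (λ y → ∑ (λ S′ → (weight S * weight S′) * χ (S Δ S′) y)))
      ≡⟨ ∑-cong (λ S → 𝔼-∑ P (λ S′ y → (weight S * weight S′) * χ (S Δ S′) y)) ⟩
    ∑ (λ S → ∑ (λ S′ → 𝔼 P (λ y → (weight S * weight S′) * χ (S Δ S′) y)))
      ≡⟨ ∑-cong (λ S → ∑-cong (λ S′ →
           trans (𝔼-*ˡ P (weight S * weight S′) (χ (S Δ S′))) (orthogonal S S′))) ⟩
    ∑ (λ S → ∑ (λ S′ → (weight S * weight S′) * 𝟙 (∣ S Δ S′ ∣ ℕ.≡ᵇ 0)))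
      ≡⟨ ∑-cong (λ S → ∑-select S (λ S′ → weight S * weight S′)) ⟩
    ∑ (λ S → weight S * weight S)
      ≡⟨ ∑-cong weight² ⟩
    ∑ (λ S → 𝟙 (F S)) ∎
    where
    weight : Subset n → ℚ
    weight S = 𝟙 (F S) * χ S x
    product : ∀ S S′ y →
      (weight S * χ S y) * (weight S′ * χ S′ y) ≡ (weight S * weight S′) * χ (S Δ S′) y
    product S S′ y = trans (*-interchange (weight S) (χ S y) (weight S′) (χ S′ y))
                           (cong ((weight S * weight S′) *_) (χ-Δ S S′ y))
    guards-first : ∀ a u b v q → ((a * u) * (b * v)) * q ≡ a * (b * ((u * v) * q))
    guards-first = solve-∀ ℚ-ring
    orthogonal : ∀ S S′ →
      (weight S * weight S′) * 𝔼 P (χ (S Δ S′)) ≡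
      (weight S * weight S′) * 𝟙 (∣ S Δ S′ ∣ ℕ.≡ᵇ 0)
    orthogonal S S′ = begin
      (weight S * weight S′) * 𝔼 P (χ (S Δ S′))
        ≡⟨ guards-first (𝟙 (F S)) (χ S x) (𝟙 (F S′)) (χ S′ x) _ ⟩
      𝟙 (F S) * (𝟙 (F S′) * ((χ S x * χ S′ x) * 𝔼 P (χ (S Δ S′))))
        ≡⟨ 𝟙-guard (F S) (λ S∈F → 𝟙-guard (F S′) (λ S′∈F →
             cong ((χ S x * χ S′ x) *_) (uniform (S Δ S′) (diameter S S′ S∈F S′∈F)))) ⟩
      𝟙 (F S) * (𝟙 (F S′) * ((χ S x * χ S′ x) * 𝟙 (∣ S Δ S′ ∣ ℕ.≡ᵇ 0)))
        ≡⟨ sym (guards-first (𝟙 (F S)) (χ S x) (𝟙 (F S′)) (χ S′ x) _) ⟩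
      (weight S * weight S′) * 𝟙 (∣ S Δ S′ ∣ ℕ.≡ᵇ 0) ∎
    weight² : ∀ S → weight S * weight S ≡ 𝟙 (F S)
    weight² S = begin
      weight S * weight S                   ≡⟨ *-interchange (𝟙 (F S)) (χ S x) (𝟙 (F S)) (χ S x) ⟩
      (𝟙 (F S) * 𝟙 (F S)) * (χ S x * χ S x) ≡⟨ cong₂ _*_ (𝟙-idem (F S)) (χ-self S x) ⟩
      𝟙 (F S) * 1ℚ                          ≡⟨ ℚ.*-identityʳ (𝟙 (F S)) ⟩
      𝟙 (F S)                               ∎

  *-nonneg : ∀ {p q} → 0ℚ ≤ p → 0ℚ ≤ q → 0ℚ ≤ p * q
  *-nonneg {p} {q} 0≤p 0≤q =
    ℚ.nonNegative⁻¹ (p * q) {{ℚ.nonNeg*nonNeg⇒nonNeg p {{nonNegative 0≤p}} q {{nonNegative 0≤q}}}}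

  square-nonneg : ∀ p → 0ℚ ≤ p * p
  square-nonneg p with ℚ.≤-total 0ℚ p
  ... | inj₁ 0≤p = *-nonneg 0≤p 0≤p
  ... | inj₂ p≤0 =
    ℚ.nonNegative⁻¹ (p * p) {{ℚ.nonPos*nonPos⇒nonPos p {{nonPositive p≤0}} p {{nonPositive p≤0}}}}

  pr*f²≤𝔼f² : ∀ {n} (P : Dist n) (f : Vec Bool n → ℚ) x →
    pr P x * (f x * f x) ≤ 𝔼 P (λ y → f y * f y)
  pr*f²≤𝔼f² P f = term≤∑ (λ y → *-nonneg (nonneg P y) (square-nonneg (f y)))

  ℕtoℚ≡mkℚ : ∀ a → ℕtoℚ a ≡ mkℚ (ℤ.+ a) 0 (coprime-sym (1-coprimeTo a))
  ℕtoℚ≡mkℚ a = ℚ.normalize-coprime (coprime-sym (1-coprimeTo a))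

  ℕtoℚ-+ : ∀ a b → ℕtoℚ (a ℕ.+ b) ≡ ℕtoℚ a + ℕtoℚ b
  ℕtoℚ-+ a b rewrite ℕtoℚ≡mkℚ a | ℕtoℚ≡mkℚ b =
    cong (_/ 1) (trans (ℤ.pos-+ a b)
                       (sym (cong₂ ℤ._+_ (ℤ.*-identityʳ (ℤ.+ a)) (ℤ.*-identityʳ (ℤ.+ b)))))

  ∑-𝟙≡count : ∀ {n} (F : Vec Bool n → Bool) → ∑ (λ S → 𝟙 (F S)) ≡ ℕtoℚ (count F)
  ∑-𝟙≡count {zero} F with F []
  ... | true  = refl
  ... | false = refl
  ∑-𝟙≡count {suc n} F =
    trans (cong₂ _+_ (∑-𝟙≡count (λ v → F (true ∷ v))) (∑-𝟙≡count (λ v → F (false ∷ v))))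
          (sym (ℕtoℚ-+ (count (λ v → F (true ∷ v))) (count (λ v → F (false ∷ v)))))

  p*N²≤N⇒p*N≤1 : ∀ p N → p * (ℕtoℚ N * ℕtoℚ N) ≤ ℕtoℚ N → p * ℕtoℚ N ≤ 1ℚ
  p*N²≤N⇒p*N≤1 p zero    _ = subst (_≤ 1ℚ) (sym (ℚ.*-zeroʳ p)) (ℚ.nonNegative⁻¹ 1ℚ)
  p*N²≤N⇒p*N≤1 p (suc N) pN²≤N = ℚ.*-cancelʳ-≤-pos (ℕtoℚ (suc N)) {{ℚ.normalize-pos (suc N) 1}}
    (subst₂ _≤_ (sym (ℚ.*-assoc p (ℕtoℚ (suc N)) (ℕtoℚ (suc N))))
                (sym (ℚ.*-identityˡ (ℕtoℚ (suc N)))) pN²≤N)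

  fourierBound : ∀ {n} d (P : Dist n) → DWiseUniform d P → (F : Subset n → Bool) → DiameterAtMost d F →
    MinEntropyAtLeastLog P (count F)
  fourierBound d P uniform F diameter x = p*N²≤N⇒p*N≤1 (pr P x) (count F)
    (subst₂ (λ p q → pr P x * (p * p) ≤ q) peak-x second-moment (pr*f²≤𝔼f² P (peak F x) x))
    where
    peak-x : peak F x x ≡ ℕtoℚ (count F)
    peak-x = trans (peak-self F x) (∑-𝟙≡count F)
    second-moment : 𝔼 P (λ y → peak F x y * peak F x y) ≡ ℕtoℚ (count F)
    second-moment = trans (𝔼-peak² d P uniform F diameter x) (∑-𝟙≡count F)

open Fourier using (DWiseIndependent⇒DWiseUniform; fourierBound)
open import Data.Nat using (_*_; _+_; _∸_; _≥_; _≤_; z≤n; s≤s; s≤s⁻¹)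
open import Data.Nat.Properties
  using (≤-refl; ≤-trans; n≤1+n; m≤n⇒m≤1+n; +-mono-≤; +-monoʳ-≤; +-comm; +-suc; +-identityʳ; <ᵇ⇒<;
         module ≤-Reasoning)
open import Data.Nat.Combinatorics using (_C_; nCk+nC[k+1]≡[n+1]C[k+1])
open import Data.Nat.ListAction using (sum)
open import Data.Nat.ListAction.Properties using (sum-++)
open import Algebra.Properties.CommutativeSemigroup ℕ.+-commutativeSemigroup
  using (interchange; xy∙z≈y∙xz)
open ≤-Reasoning

binomSum-suc : ∀ n k → binomSum n (suc k) ≡ binomSum n k + n C suc k
binomSum-suc n k = begin-equality
  sum (map (n C_) (upTo (suc (suc k))))
    ≡⟨ cong (λ ks → sum (map (n C_) ks)) (sym (List.upTo-∷ʳ (suc k))) ⟩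
  sum (map (n C_) (upTo (suc k) ++ suc k ∷ []))
    ≡⟨ cong sum (List.map-++ (n C_) (upTo (suc k)) (suc k ∷ [])) ⟩
  sum (map (n C_) (upTo (suc k)) ++ n C suc k ∷ [])
    ≡⟨ sum-++ (map (n C_) (upTo (suc k))) (n C suc k ∷ []) ⟩
  binomSum n k + (n C suc k + 0)
    ≡⟨ cong (binomSum n k +_) (+-identityʳ (n C suc k)) ⟩
  binomSum n k + n C suc k ∎

binomSum-pascal : ∀ n k → binomSum (suc n) (suc k) ≡ binomSum n k + binomSum n (suc k)
binomSum-pascal n zero = begin-equality
  binomSum (suc n) 1       ≡⟨ binomSum-suc (suc n) 0 ⟩
  1 + suc n C 1            ≡⟨ cong (1 +_) (sym (nCk+nC[k+1]≡[n+1]C[k+1] n 0)) ⟩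
  1 + (n C 0 + n C 1)      ≡⟨ cong (1 +_) (sym (binomSum-suc n 0)) ⟩
  1 + binomSum n 1         ∎
binomSum-pascal n (suc k) = begin-equality
  binomSum (suc n) (suc (suc k))
    ≡⟨ binomSum-suc (suc n) (suc k) ⟩
  binomSum (suc n) (suc k) + suc n C suc (suc k)
    ≡⟨ cong₂ _+_ (binomSum-pascal n k) (sym (nCk+nC[k+1]≡[n+1]C[k+1] n (suc k))) ⟩
  (binomSum n k + binomSum n (suc k)) + (n C suc k + n C suc (suc k))
    ≡⟨ interchange (binomSum n k) (binomSum n (suc k)) (n C suc k) (n C suc (suc k)) ⟩
  (binomSum n k + n C suc k) + (binomSum n (suc k) + n C suc (suc k))
    ≡⟨ sym (cong₂ _+_ (binomSum-suc n k) (binomSum-suc n (suc k))) ⟩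
  binomSum n (suc k) + binomSum n (suc (suc k)) ∎

binomSum-odd : ∀ m k → binomSum (suc m) k + m C k ≡ binomSum m k + binomSum m k
binomSum-odd m zero    = refl
binomSum-odd m (suc k) = begin-equality
  binomSum (suc m) (suc k) + m C suc k
    ≡⟨ cong (_+ m C suc k) (binomSum-pascal m k) ⟩
  (binomSum m k + binomSum m (suc k)) + m C suc k
    ≡⟨ xy∙z≈y∙xz (binomSum m k) (binomSum m (suc k)) (m C suc k) ⟩
  binomSum m (suc k) + (binomSum m k + m C suc k)
    ≡⟨ cong (binomSum m (suc k) +_) (sym (binomSum-suc m k)) ⟩
  binomSum m (suc k) + binomSum m (suc k) ∎

count-false : ∀ n → count {n} (λ _ → false) ≡ 0
count-false zero    = refl
count-false (suc n) = cong₂ _+_ (count-false n) (count-false n)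

count-atMost : ∀ n k → count (atMost {n} k) ≡ binomSum n k
count-atMost zero    zero    = refl
count-atMost zero    (suc k) =
  trans (count-atMost zero k) (sym (trans (binomSum-suc 0 k) (+-identityʳ (binomSum 0 k))))
count-atMost (suc n) zero    = trans (cong (_+ count (atMost {n} 0)) (count-false n)) (count-atMost n zero)
count-atMost (suc n) (suc k) =
  trans (cong₂ _+_ (count-atMost n k) (count-atMost n (suc k))) (sym (binomSum-pascal n k))

∣Δ∣≤∣∣+∣∣ : ∀ {n} (S S′ : Subset n) → ∣ S Δ S′ ∣ ≤ ∣ S ∣ + ∣ S′ ∣
∣Δ∣≤∣∣+∣∣ []          []           = z≤n
∣Δ∣≤∣∣+∣∣ (true  ∷ S) (true  ∷ S′) =
  m≤n⇒m≤1+n (≤-trans (∣Δ∣≤∣∣+∣∣ S S′) (+-monoʳ-≤ ∣ S ∣ (n≤1+n ∣ S′ ∣)))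
∣Δ∣≤∣∣+∣∣ (true  ∷ S) (false ∷ S′) = s≤s (∣Δ∣≤∣∣+∣∣ S S′)
∣Δ∣≤∣∣+∣∣ (false ∷ S) (true  ∷ S′) =
  subst (suc ∣ S Δ S′ ∣ ≤_) (sym (+-suc ∣ S ∣ ∣ S′ ∣)) (s≤s (∣Δ∣≤∣∣+∣∣ S S′))
∣Δ∣≤∣∣+∣∣ (false ∷ S) (false ∷ S′) = ∣Δ∣≤∣∣+∣∣ S S′

∣∷∣≤1+∣∣ : ∀ {n} b (S : Subset n) → ∣ b ∷ S ∣ ≤ suc ∣ S ∣
∣∷∣≤1+∣∣ true  S = ≤-refl
∣∷∣≤1+∣∣ false S = n≤1+n ∣ S ∣

atMost⇒≤ : ∀ {n} k (S : Subset n) → T (atMost k S) → ∣ S ∣ ≤ k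
atMost⇒≤ k S S≤k = s≤s⁻¹ (<ᵇ⇒< ∣ S ∣ (suc k) S≤k)

diameter-atMost : ∀ {n} k → DiameterAtMost (2 * k) (atMost {n} k)
diameter-atMost k S S′ S≤k S′≤k = begin
  ∣ S Δ S′ ∣    ≤⟨ ∣Δ∣≤∣∣+∣∣ S S′ ⟩
  ∣ S ∣ + ∣ S′ ∣ ≤⟨ +-mono-≤ (atMost⇒≤ k S S≤k) (atMost⇒≤ k S′ S′≤k) ⟩
  k + k         ≡⟨ cong (k +_) (sym (+-identityʳ k)) ⟩
  2 * k         ∎

diameter-atMost∘tail : ∀ {n} k → DiameterAtMost (2 * k + 1) (atMost {n} k ∘ tail)
diameter-atMost∘tail k (b ∷ S) (b′ ∷ S′) S≤k S′≤k = begin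
  ∣ (b xor b′) ∷ (S Δ S′) ∣ ≤⟨ ∣∷∣≤1+∣∣ (b xor b′) (S Δ S′) ⟩
  suc ∣ S Δ S′ ∣            ≤⟨ s≤s (diameter-atMost k S S′ S≤k S′≤k) ⟩
  suc (2 * k)               ≡⟨ +-comm 1 (2 * k) ⟩
  2 * k + 1                 ∎

mainTheorem6 : (n d : ℕ) → n ≥ 1 → d ≥ 1 → (P : Dist n) →
    Unbiased P → DWiseIndependent d P →
    (∀ k → d ≡ 2 * k → MinEntropyAtLeastLog P (binomSum n k))
    × (∀ k → d ≡ 2 * k + 1 →
         MinEntropyAtLeastLog P (binomSum n k + (n ∸ 1) C k))
mainTheorem6 zero    d () _ P unbiased independent
mainTheorem6 (suc m) d _  _ P unbiased independent = even , odd
  where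
  bound : ∀ {F} → DiameterAtMost d F → MinEntropyAtLeastLog P (count F)
  bound = fourierBound d P (DWiseIndependent⇒DWiseUniform d {P} unbiased independent) _

  even : ∀ k → d ≡ 2 * k → MinEntropyAtLeastLog P (binomSum (suc m) k)
  even k d≡2k = subst (MinEntropyAtLeastLog P) (count-atMost (suc m) k)
    (bound (subst (λ e → DiameterAtMost e (atMost k)) (sym d≡2k) (diameter-atMost k)))

  odd : ∀ k → d ≡ 2 * k + 1 → MinEntropyAtLeastLog P (binomSum (suc m) k + m C k)
  odd k d≡2k+1 = subst (MinEntropyAtLeastLog P)
    (trans (cong₂ _+_ (count-atMost m k) (count-atMost m k)) (sym (binomSum-odd m k)))
    (bound (subst (λ e → DiameterAtMost e (atMost k ∘ tail)) (sym d≡2k+1) (diameter-atMost∘tail k)))
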